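{- The logics $\mathbf{PM1}$ and $\mathbf{PM4}$ have projective unification, and they have unitary type of unification.
   Context: $\mathbf{PM1}$ is the normal modal logic of all finite chains $\langle\{1,\dots,m\},\le\rangle$ (equivalently $\mathcal{S}4.3+\mathcal{G}rz$, where $\mathcal{S}4.3=\mathcal{S}4+\Box(\Box p\to q)\vee\Box(\Box q\to p)$ and $\mathcal{G}rz=\mathcal{S}4+(\Box(\Box(p\to\Box p)\to p)\to p)$). $\mathbf{PM4}$ is the normal modal logic of all finite frames $\langle\{0,1,\dots,m\},R\rangle$, $m\ge1$, with $xRy\iff(x\le m-1\ \text{or}\ y=m)$. A unifier of $\varphi(p_1,\dots,p_s)$ in $\mathcal{L}$ is a substitution $\sigma$ with $\sigma(\varphi)\in\mathcal{L}$. $\varphi$ is projective in $\mathcal{L}$ if it has a unifier $\tau$ with $\Box\varphi\to(p_i\leftrightarrow\tau(p_i))\in\mathcal{L}$ for all $p_i$; $\mathcal{L}$ has projective unification if every unifiable formula is projective. $\sigma$ is more general than $\sigma^1$ if $\sigma^1(p_i)\leftrightarrow\sigma^2(\sigma(p_i))\in\mathcal{L}$ for some substitution $\sigma^2$ and all $p_i$; an mgu is a unifier more general than every unifier; $\mathcal{L}$ has unitary type if every unifiable formula has an mgu. -}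

module Defs where

open import Data.Nat using (ℕ; zero; suc; _≤ᵇ_; _≡ᵇ_)
open import Data.Fin using (Fin; toℕ)
open import Data.Bool using (Bool; true; false; _∧_; _∨_; not)
open import Data.List using (List; []; _∷_; _++_)
open import Data.List.Membership.Propositional using (_∈_)
open import Data.Product using (Σ; _×_; ∃)
open import Relation.Binary.PropositionalEquality using (_≡_)

infixr 5 _⇒_
infixr 6 _∨ᶠ_
infixr 7 _∧ᶠ_

data Fm : Set where
  var  : ℕ → Fm
  ⊥ᶠ   : Fm
  _⇒_  : Fm → Fm → Fm
  _∧ᶠ_ : Fm → Fm → Fm
  _∨ᶠ_ : Fm → Fm → Fm
  □    : Fm → Fm

_⇔_ : Fm → Fm → Fm
φ ⇔ ψ = (φ ⇒ ψ) ∧ᶠ (ψ ⇒ φ)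

vars : Fm → List ℕ
vars (var p)    = p ∷ []
vars ⊥ᶠ         = []
vars (φ ⇒ ψ)    = vars φ ++ vars ψ
vars (φ ∧ᶠ ψ)   = vars φ ++ vars ψ
vars (φ ∨ᶠ ψ)   = vars φ ++ vars ψ
vars (□ φ)      = vars φ

Subst : Set
Subst = ℕ → Fm

_[_] : Fm → Subst → Fm
var p    [ σ ] = σ p
⊥ᶠ       [ σ ] = ⊥ᶠ
(φ ⇒ ψ)  [ σ ] = (φ [ σ ]) ⇒ (ψ [ σ ])
(φ ∧ᶠ ψ) [ σ ] = (φ [ σ ]) ∧ᶠ (ψ [ σ ])
(φ ∨ᶠ ψ) [ σ ] = (φ [ σ ]) ∨ᶠ (ψ [ σ ])
□ φ      [ σ ] = □ (φ [ σ ])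

record FinFrame : Set where
  field
    size : ℕ
    R    : Fin size → Fin size → Bool
open FinFrame public

allFin : (n : ℕ) → (Fin n → Bool) → Bool
allFin zero    f = true
allFin (suc n) f = f Fin.zero ∧ allFin n (λ i → f (Fin.suc i))

eval : (F : FinFrame) → (ℕ → Fin (size F) → Bool) → Fin (size F) → Fm → Bool
eval F V x (var p)  = V p x
eval F V x ⊥ᶠ       = false
eval F V x (φ ⇒ ψ)  = not (eval F V x φ) ∨ eval F V x ψ
eval F V x (φ ∧ᶠ ψ) = eval F V x φ ∧ eval F V x ψ
eval F V x (φ ∨ᶠ ψ) = eval F V x φ ∨ eval F V x ψ
eval F V x (□ φ)    = allFin (size F) (λ y → not (R F x y) ∨ eval F V y φ)

ValidIn : FinFrame → Fm → Set
ValidIn F φ = (V : ℕ → Fin (size F) → Bool) (x : Fin (size F)) → eval F V x φ ≡ true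

Logic : Set₁
Logic = Fm → Set

-- the chain ⟨{1,…,m},≤⟩ with m = k+1 ≥ 1  (element i ∈ Fin m represents i+1)
chain : ℕ → FinFrame
chain k = record { size = suc k ; R = λ x y → toℕ x ≤ᵇ toℕ y }

-- the frame ⟨{0,…,m},R⟩ with m = k+1 ≥ 1, xRy ⟺ (x ≤ m-1 or y = m)
pm4Frame : ℕ → FinFrame
pm4Frame k = record { size = suc (suc k)
                    ; R = λ x y → (toℕ x ≤ᵇ k) ∨ (toℕ y ≡ᵇ suc k) }

PM1 : Logic
PM1 φ = (k : ℕ) → ValidIn (chain k) φ

PM4 : Logic
PM4 φ = (k : ℕ) → ValidIn (pm4Frame k) φ

module _ (L : Logic) where

  Unifier : Fm → Subst → Set
  Unifier φ σ = L (φ [ σ ])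

  Unifiable : Fm → Set
  Unifiable φ = ∃ λ σ → Unifier φ σ

  Projective : Fm → Set
  Projective φ = ∃ λ τ → Unifier φ τ ×
                   ((p : ℕ) → p ∈ vars φ → L (□ φ ⇒ (var p ⇔ τ p)))

  ProjectiveUnification : Set
  ProjectiveUnification = (φ : Fm) → Unifiable φ → Projective φ

  MoreGeneral : Fm → Subst → Subst → Set
  MoreGeneral φ σ σ₁ = ∃ λ σ₂ → (p : ℕ) → p ∈ vars φ → L (σ₁ p ⇔ (σ p [ σ₂ ]))

  MGU : Fm → Subst → Set
  MGU φ σ = Unifier φ σ × ((σ₁ : Subst) → Unifier φ σ₁ → MoreGeneral φ σ σ₁)

  UnitaryType : Set
  UnitaryType = (φ : Fm) → Unifiable φ → ∃ λ σ → MGU φ σ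

{-# OPTIONS --safe #-}
module Submission where

-- Write A = □φ and S for the set of A-points of a model; S is upward closed.  The unifier
-- keeps every variable on S, and at worlds that see no point of S it makes p the constant
-- given by a ground unifier, so φ holds there by classical evaluation.  Every remaining world
-- w lies strictly below S and, the frame being connected, sees all of S.  There the unifier
-- tests, for each boxed subformula ψ of φ, whether ψ holds throughout S, strengthens A to the
-- formula D saying that □ψ holds only for those ψ, and copies the valuation at the last
-- D-point e.  D holds at the first point of S, so e exists; it is the unique last D-point
-- because the only proper cluster is the root, which sees w.  By induction on subformulas,
-- w then evaluates every subformula of φ as e does, and φ holds at e.  Finally, a projective
-- unifier is an mgu, so unification is also unitary.

open import Defs
open import Data.Bool using (Bool; true; false; _∧_; _∨_; not; if_then_else_)
open import Data.Bool.Properties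
  using (∨-identityʳ; ∨-zeroʳ; ∧-conicalˡ; ∧-conicalʳ; ⇔→≡; T-≡; if-float; if-cong; if-cong₂; if-cong-else)
open import Data.Empty using (⊥-elim)
open import Data.Fin using (Fin; toℕ; _≟_)
open import Data.Fin.Properties using (toℕ-injective; toℕ<n)
open import Data.List using (List; []; _∷_; _++_)
open import Data.List.Base using () renaming (allFin to enumerate)
open import Data.List.Membership.Propositional using (_∈_)
open import Data.List.Membership.Propositional.Properties using (∈-allFin)
open import Data.List.Relation.Binary.Subset.Propositional using (_⊆_)
open import Data.List.Relation.Binary.Subset.Propositional.Properties using (xs⊆xs++ys; xs⊆ys++xs)
open import Data.List.Relation.Unary.Any using (here; there)
open import Data.Nat using (ℕ; zero; suc; _≤_; _≤ᵇ_; _≡ᵇ_; s≤s⁻¹)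
open import Data.Nat.Properties
  using (≤ᵇ⇒≤; ≤⇒≤ᵇ; ≡ᵇ⇒≡; ≡⇒≡ᵇ; ≤-refl; ≤-trans; ≤-total; ≤-antisym; ≰⇒>; 1+n≰n)
open import Data.Product using (Σ; _×_; _,_; proj₁; proj₂)
open import Data.Sum using (_⊎_; inj₁; inj₂)
open import Function using (id; _∘_)
open import Function.Bundles using (mk⇔; Equivalence)
open import Relation.Nullary using (yes; no)
open import Relation.Binary.PropositionalEquality
  using (_≡_; _≢_; refl; sym; trans; cong; cong₂; subst; _≗_; module ≡-Reasoning)

open ≡-Reasoning

absurdᵇ : ∀ {b} {A : Set} → b ≡ true → b ≡ false → A
absurdᵇ refl ()

≡-by-iff : ∀ {a b} → (a ≡ true → b ≡ true) → (b ≡ true → a ≡ true) → a ≡ b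
≡-by-iff f g = ⇔→≡ (mk⇔ f g)

allFin-intro : ∀ n (f : Fin n → Bool) → (∀ i → f i ≡ true) → allFin n f ≡ true
allFin-intro zero    f h = refl
allFin-intro (suc n) f h = cong₂ _∧_ (h Fin.zero) (allFin-intro n (f ∘ Fin.suc) (h ∘ Fin.suc))

allFin-elim : ∀ n (f : Fin n → Bool) → allFin n f ≡ true → ∀ i → f i ≡ true
allFin-elim (suc n) f h Fin.zero    = ∧-conicalˡ _ _ h
allFin-elim (suc n) f h (Fin.suc i) = allFin-elim n (f ∘ Fin.suc) (∧-conicalʳ _ _ h) i

allFin-cong : ∀ n {f g : Fin n → Bool} → f ≗ g → allFin n f ≡ allFin n g
allFin-cong zero    h = refl
allFin-cong (suc n) h = cong₂ _∧_ (h Fin.zero) (allFin-cong n (h ∘ Fin.suc))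

allFin-false : ∀ n (f : Fin n → Bool) → allFin n f ≡ false → Σ (Fin n) λ i → f i ≡ false
allFin-false (suc n) f h with f Fin.zero in f0
... | false = Fin.zero , f0
... | true with allFin-false n (f ∘ Fin.suc) h
...   | i , fi = Fin.suc i , fi

module Greatest {A : Set} (_≼_ : A → A → Bool)
  (≼-trans : ∀ {x y z} → x ≼ y ≡ true → y ≼ z ≡ true → x ≼ z ≡ true)
  (≼-total : ∀ x y → x ≼ y ≡ true ⊎ y ≼ x ≡ true)
  (P : A → Bool) where

  ≼-refl : ∀ x → x ≼ x ≡ true
  ≼-refl x with ≼-total x x
  ... | inj₁ x≼x = x≼x
  ... | inj₂ x≼x = x≼x

  GreatestIn : List A → Set
  GreatestIn xs = Σ A λ e → P e ≡ true × (∀ {y} → y ∈ xs → P y ≡ true → y ≼ e ≡ true)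

  greatest-in : ∀ xs → (∀ {y} → y ∈ xs → P y ≡ false) ⊎ GreatestIn xs
  greatest-in [] = inj₁ λ ()
  greatest-in (a ∷ xs) with greatest-in xs | P a in Pa
  ... | inj₁ none | false = inj₁ λ { (here refl) → Pa ; (there y∈) → none y∈ }
  ... | inj₁ none | true  =
    inj₂ (a , Pa , λ { (here refl) _ → ≼-refl a ; (there y∈) Py → absurdᵇ Py (none y∈) })
  ... | inj₂ (e , Pe , below) | false =
    inj₂ (e , Pe , λ { (here refl) Py → absurdᵇ Py Pa ; (there y∈) → below y∈ })
  ... | inj₂ (e , Pe , below) | true with ≼-total a e
  ...   | inj₁ a≼e = inj₂ (e , Pe , λ { (here refl) _ → a≼e ; (there y∈) → below y∈ })
  ...   | inj₂ e≼a =
    inj₂ (a , Pa , λ { (here refl) _ → ≼-refl a ; (there y∈) Py → ≼-trans (below y∈ Py) e≼a })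

  greatest : (xs : List A) → (∀ x → x ∈ xs) → ∀ {s} → P s ≡ true →
             Σ A λ e → P e ≡ true × (∀ {y} → P y ≡ true → y ≼ e ≡ true)
  greatest xs complete {s} Ps with greatest-in xs
  ... | inj₁ none = absurdᵇ Ps (none (complete s))
  ... | inj₂ (e , Pe , below) = e , Pe , below (complete _)

¬ᶠ : Fm → Fm
¬ᶠ χ = χ ⇒ ⊥ᶠ

◇ : Fm → Fm
◇ χ = ¬ᶠ (□ (¬ᶠ χ))

constᶠ : Bool → Fm
constᶠ true  = ¬ᶠ ⊥ᶠ
constᶠ false = ⊥ᶠ

ifᶠ_then_else_ : Fm → Fm → Fm → Fm
ifᶠ a then b else c = (a ∧ᶠ b) ∨ᶠ (¬ᶠ a ∧ᶠ c)

boxedSubformulas : Fm → List Fm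
boxedSubformulas (var p)  = []
boxedSubformulas ⊥ᶠ       = []
boxedSubformulas (φ ⇒ ψ)  = boxedSubformulas φ ++ boxedSubformulas ψ
boxedSubformulas (φ ∧ᶠ ψ) = boxedSubformulas φ ++ boxedSubformulas ψ
boxedSubformulas (φ ∨ᶠ ψ) = boxedSubformulas φ ++ boxedSubformulas ψ
boxedSubformulas (□ φ)    = φ ∷ boxedSubformulas φ

-- At a world seeing a D-point e that sees no other D-point, this says that p holds at e.
atLast : Fm → ℕ → Fm
atLast D p = ◇ (D ∧ᶠ □ (D ⇒ var p))

infixl 7 _∧¬□_
_∧¬□_ : Fm → Fm → Fm
D ∧¬□ ψ = D ∧ᶠ ¬ᶠ (□ ψ)

refine : (Fm → Bool) → List Fm → Fm → Fm
refine k []       D = D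
refine k (ψ ∷ ψs) D = refine k ψs (if k ψ then D else D ∧¬□ ψ)

atLastRefined : Fm → List Fm → Fm → ℕ → Fm
atLastRefined A []       D p = atLast D p
atLastRefined A (ψ ∷ ψs) D p =
  ifᶠ □ (A ⇒ ψ) then atLastRefined A ψs D p else atLastRefined A ψs (D ∧¬□ ψ) p

unifier : Fm → (ℕ → Bool) → Subst
unifier φ c p =
  ifᶠ □ φ then var p
  else ifᶠ ◇ (□ φ) then atLastRefined (□ φ) (boxedSubformulas φ) (□ φ) p
  else constᶠ (c p)

refine-cong : ∀ {k k'} ψs D → k ≗ k' → refine k ψs D ≡ refine k' ψs D
refine-cong []       D h = refl
refine-cong {k' = k'} (ψ ∷ ψs) D h =
  trans (refine-cong ψs _ h) (cong (λ b → refine k' ψs (if b then D else D ∧¬□ ψ)) (h ψ))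

-- evaluation at a reflexive point that sees no other point
bval : (ℕ → Bool) → Fm → Bool
bval b (var p)  = b p
bval b ⊥ᶠ       = false
bval b (φ ⇒ ψ)  = not (bval b φ) ∨ bval b ψ
bval b (φ ∧ᶠ ψ) = bval b φ ∧ bval b ψ
bval b (φ ∨ᶠ ψ) = bval b φ ∨ bval b ψ
bval b (□ φ)    = bval b φ

bval-subst : ∀ b φ σ → bval b (φ [ σ ]) ≡ bval (λ p → bval b (σ p)) φ
bval-subst b (var p)  σ = refl
bval-subst b ⊥ᶠ       σ = refl
bval-subst b (φ ⇒ ψ)  σ = cong₂ (λ u v → not u ∨ v) (bval-subst b φ σ) (bval-subst b ψ σ)
bval-subst b (φ ∧ᶠ ψ) σ = cong₂ _∧_ (bval-subst b φ σ) (bval-subst b ψ σ)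
bval-subst b (φ ∨ᶠ ψ) σ = cong₂ _∨_ (bval-subst b φ σ) (bval-subst b ψ σ)
bval-subst b (□ φ)    σ = bval-subst b φ σ

module Semantics (F : FinFrame) where

  Point : Set
  Point = Fin (size F)

  Valuation : Set
  Valuation = ℕ → Point → Bool

  _⇝_ : Point → Point → Bool
  x ⇝ y = R F x y

  ev : Valuation → Point → Fm → Bool
  ev = eval F

  ⇒-intro : ∀ V x a b → (ev V x a ≡ true → ev V x b ≡ true) → ev V x (a ⇒ b) ≡ true
  ⇒-intro V x a b h with ev V x a
  ... | true  = h refl
  ... | false = refl

  ⇒-elim : ∀ V x a b → ev V x (a ⇒ b) ≡ true → ev V x a ≡ true → ev V x b ≡ true
  ⇒-elim V x a b h ha rewrite ha = h

  ⇔-intro : ∀ V x a b → ev V x a ≡ ev V x b → ev V x (a ⇔ b) ≡ true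
  ⇔-intro V x a b h rewrite h with ev V x b
  ... | true  = refl
  ... | false = refl

  □-intro : ∀ V x χ → (∀ y → x ⇝ y ≡ true → ev V y χ ≡ true) → ev V x (□ χ) ≡ true
  □-intro V x χ h = allFin-intro _ _ at
    where
    at : ∀ y → not (x ⇝ y) ∨ ev V y χ ≡ true
    at y with x ⇝ y in xy
    ... | true  = h y xy
    ... | false = refl

  □-elim : ∀ V x χ → ev V x (□ χ) ≡ true → ∀ y → x ⇝ y ≡ true → ev V y χ ≡ true
  □-elim V x χ h y xy with allFin-elim _ _ h y
  ... | at rewrite xy = at

  ◇-intro : ∀ V x χ y → x ⇝ y ≡ true → ev V y χ ≡ true → ev V x (◇ χ) ≡ true
  ◇-intro V x χ y xy hy with ev V x (□ (¬ᶠ χ)) in □¬χ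
  ... | false = refl
  ... | true  = absurdᵇ (□-elim V x (¬ᶠ χ) □¬χ y xy) (cong (λ b → not b ∨ false) hy)

  ◇-elim : ∀ V x χ → ev V x (◇ χ) ≡ true → Σ Point λ y → x ⇝ y ≡ true × ev V y χ ≡ true
  ◇-elim V x χ h with ev V x (□ (¬ᶠ χ)) in □¬χ
  ... | false with allFin-false _ _ □¬χ
  ...   | y , fy with x ⇝ y in xy | ev V y χ in hy
  ...     | true  | true  = y , xy , hy
  ...     | true  | false = absurdᵇ refl fy
  ...     | false | _     = absurdᵇ refl fy

  eval-ifᶠ : ∀ V x a b c →
             ev V x (ifᶠ a then b else c) ≡ (if ev V x a then ev V x b else ev V x c)
  eval-ifᶠ V x a b c with ev V x a
  ... | true  = ∨-identityʳ _
  ... | false = refl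

  eval-constᶠ : ∀ V x b → ev V x (constᶠ b) ≡ b
  eval-constᶠ V x true  = refl
  eval-constᶠ V x false = refl

  eval-subst : ∀ V x ψ σ → ev V x (ψ [ σ ]) ≡ ev (λ p y → ev V y (σ p)) x ψ
  eval-subst V x (var p)  σ = refl
  eval-subst V x ⊥ᶠ       σ = refl
  eval-subst V x (φ ⇒ ψ)  σ = cong₂ (λ u v → not u ∨ v) (eval-subst V x φ σ) (eval-subst V x ψ σ)
  eval-subst V x (φ ∧ᶠ ψ) σ = cong₂ _∧_ (eval-subst V x φ σ) (eval-subst V x ψ σ)
  eval-subst V x (φ ∨ᶠ ψ) σ = cong₂ _∨_ (eval-subst V x φ σ) (eval-subst V x ψ σ)
  eval-subst V x (□ φ)    σ = allFin-cong _ λ y → cong (not (x ⇝ y) ∨_) (eval-subst V y φ σ)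

  refine-sound : ∀ V y k ψs D → ev V y (refine k ψs D) ≡ true →
                 ev V y D ≡ true × (∀ {ψ} → ψ ∈ ψs → ev V y (□ ψ) ≡ true → k ψ ≡ true)
  refine-sound V y k [] D h = h , λ ()
  refine-sound V y k (ψ ∷ ψs) D h with k ψ in kψ | refine-sound V y k ψs _ h
  ... | true  | hD , rest = hD , λ { (here refl) _ → kψ ; (there ψ∈) → rest ψ∈ }
  ... | false | hD¬ , rest =
    ∧-conicalˡ _ _ hD¬ ,
    λ { (here refl) □ψ → absurdᵇ (∧-conicalʳ _ _ hD¬) (cong (λ b → not b ∨ false) □ψ)
      ; (there ψ∈) → rest ψ∈ }

  refine-complete : ∀ V y k ψs D → ev V y D ≡ true →
                    (∀ {ψ} → ψ ∈ ψs → ev V y (□ ψ) ≡ true → k ψ ≡ true) →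
                    ev V y (refine k ψs D) ≡ true
  refine-complete V y k [] D hD h = hD
  refine-complete V y k (ψ ∷ ψs) D hD h with k ψ in kψ
  ... | true  = refine-complete V y k ψs D hD (h ∘ there)
  ... | false = refine-complete V y k ψs _ (cong₂ _∧_ hD ¬□ψ) (h ∘ there)
    where
    ¬□ψ : not (ev V y (□ ψ)) ∨ false ≡ true
    ¬□ψ with ev V y (□ ψ) in □ψ
    ... | true  = absurdᵇ (h (here refl) □ψ) kψ
    ... | false = refl

  eval-atLastRefined : ∀ V w A ψs D p →
    ev V w (atLastRefined A ψs D p) ≡ ev V w (atLast (refine (λ ψ → ev V w (□ (A ⇒ ψ))) ψs D) p)
  eval-atLastRefined V w A []       D p = refl
  eval-atLastRefined V w A (ψ ∷ ψs) D p = begin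
    ev V w (ifᶠ □ (A ⇒ ψ) then kept else refined) ≡⟨ eval-ifᶠ V w (□ (A ⇒ ψ)) kept refined ⟩
    (if b then ev V w kept else ev V w refined)    ≡⟨ if-cong₂ b (eval-atLastRefined V w A ψs D p)
                                                                 (eval-atLastRefined V w A ψs (D ∧¬□ ψ) p) ⟩
    (if b then lastOf D else lastOf (D ∧¬□ ψ))     ≡⟨ if-float lastOf b ⟨
    lastOf (if b then D else D ∧¬□ ψ)              ∎
    where
    kept refined : Fm
    kept    = atLastRefined A ψs D p
    refined = atLastRefined A ψs (D ∧¬□ ψ) p
    b : Bool
    b = ev V w (□ (A ⇒ ψ))
    lastOf : Fm → Bool
    lastOf D' = ev V w (atLast (refine (λ ψ → ev V w (□ (A ⇒ ψ))) ψs D') p)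

  valid-subst : ∀ ψ σ → ValidIn F ψ → ValidIn F (ψ [ σ ])
  valid-subst ψ σ h V x = trans (eval-subst V x ψ σ) (h _ x)

  valid-□-mp : ∀ a b → ValidIn F (□ a ⇒ b) → ValidIn F a → ValidIn F b
  valid-□-mp a b h ha V x = ⇒-elim V x (□ a) b (h V x) (□-intro V x a λ y _ → ha V y)

-- A finite S4.3-frame in which every proper cluster is the root cluster.
record IsRootClusterChain (F : FinFrame) : Set where
  open Semantics F using (_⇝_)
  field
    reflexive    : ∀ x → x ⇝ x ≡ true
    transitive   : ∀ {x y z} → x ⇝ y ≡ true → y ⇝ z ≡ true → x ⇝ z ≡ true
    connected    : ∀ x y → x ⇝ y ≡ true ⊎ y ⇝ x ≡ true
    cluster-root : ∀ {x y} → x ⇝ y ≡ true → y ⇝ x ≡ true → x ≢ y → ∀ z → x ⇝ z ≡ true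

module RootClusterChain {F : FinFrame} (isF : IsRootClusterChain F) where
  open Semantics F
  open IsRootClusterChain isF

  eval-local : ∀ {V V' x} ψ → (∀ p {y} → x ⇝ y ≡ true → V p y ≡ V' p y) → ev V x ψ ≡ ev V' x ψ
  eval-local {x = x} (var p) h = h p (reflexive x)
  eval-local ⊥ᶠ       h = refl
  eval-local (φ ⇒ ψ)  h = cong₂ (λ u v → not u ∨ v) (eval-local φ h) (eval-local ψ h)
  eval-local (φ ∧ᶠ ψ) h = cong₂ _∧_ (eval-local φ h) (eval-local ψ h)
  eval-local (φ ∨ᶠ ψ) h = cong₂ _∨_ (eval-local φ h) (eval-local ψ h)
  eval-local {V} {V'} {x} (□ φ) h = allFin-cong _ at
    where
    at : ∀ y → not (x ⇝ y) ∨ ev V y φ ≡ not (x ⇝ y) ∨ ev V' y φ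
    at y with x ⇝ y in xy
    ... | true  = eval-local φ λ p yz → h p (transitive xy yz)
    ... | false = refl

  eval-constant : ∀ b ψ x → ev (λ p _ → b p) x ψ ≡ bval b ψ
  eval-constant b (var p)  x = refl
  eval-constant b ⊥ᶠ       x = refl
  eval-constant b (φ ⇒ ψ)  x = cong₂ (λ u v → not u ∨ v) (eval-constant b φ x) (eval-constant b ψ x)
  eval-constant b (φ ∧ᶠ ψ) x = cong₂ _∧_ (eval-constant b φ x) (eval-constant b ψ x)
  eval-constant b (φ ∨ᶠ ψ) x = cong₂ _∨_ (eval-constant b φ x) (eval-constant b ψ x)
  eval-constant b (□ φ)    x =
    ≡-by-iff (λ h → trans (sym (eval-constant b φ x)) (□-elim V x φ h x (reflexive x)))
             (λ h → □-intro V x φ λ y _ → trans (eval-constant b φ y) h)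
    where
    V : Valuation
    V p _ = b p

  greatest-point : ∀ (P : Point → Bool) {s} → P s ≡ true →
                   Σ Point λ e → P e ≡ true × (∀ {y} → P y ≡ true → y ⇝ e ≡ true)
  greatest-point P = Greatest.greatest _⇝_ transitive connected P (enumerate _) ∈-allFin

  least-point : ∀ (P : Point → Bool) {s} → P s ≡ true →
                Σ Point λ e → P e ≡ true × (∀ {y} → P y ≡ true → e ⇝ y ≡ true)
  least-point P =
    Greatest.greatest (λ x y → y ⇝ x) (λ xy yz → transitive yz xy) (λ x y → connected y x)
                      P (enumerate _) ∈-allFin

  module UnifierModel (φ : Fm) (c : ℕ → Bool) (c-sat : bval c φ ≡ true) (V : Valuation) where

    A : Fm
    A = □ φ

    boxedφ : List Fm
    boxedφ = boxedSubformulas φ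

    inS : Point → Bool
    inS y = ev V y A

    V' : Valuation
    V' p y = ev V y (unifier φ c p)

    S-upward : ∀ {y z} → inS y ≡ true → y ⇝ z ≡ true → inS z ≡ true
    S-upward {y} {z} hy yz = □-intro V z φ λ u zu → □-elim V y φ hy u (transitive yz zu)

    sees-S : ∀ {w y} → inS w ≡ false → inS y ≡ true → w ⇝ y ≡ true
    sees-S {w} {y} hw hy with connected w y
    ... | inj₁ wy = wy
    ... | inj₂ yw = absurdᵇ (S-upward hy yw) hw

    copyBranch : ℕ → Fm
    copyBranch = atLastRefined A boxedφ A

    belowBranch : ℕ → Fm
    belowBranch p = ifᶠ ◇ A then copyBranch p else constᶠ (c p)

    eval-unifier : ∀ p y → V' p y ≡ (if inS y then V p y else ev V y (belowBranch p))
    eval-unifier p y = eval-ifᶠ V y A (var p) (belowBranch p)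

    eval-belowBranch : ∀ p y →
                       ev V y (belowBranch p) ≡ (if ev V y (◇ A) then ev V y (copyBranch p) else c p)
    eval-belowBranch p y = trans (eval-ifᶠ V y (◇ A) (copyBranch p) (constᶠ (c p)))
                                 (if-cong-else (ev V y (◇ A)) (eval-constᶠ V y (c p)))

    unifier-on-S : ∀ {p y} → inS y ≡ true → V' p y ≡ V p y
    unifier-on-S {p} {y} hy = trans (eval-unifier p y) (if-cong hy)

    unifier-unseen : ∀ {p y} → inS y ≡ false → ev V y (◇ A) ≡ false → V' p y ≡ c p
    unifier-unseen {p} {y} hy hd =
      trans (eval-unifier p y) (trans (if-cong hy) (trans (eval-belowBranch p y) (if-cong hd)))

    unifier-seen : ∀ {p y} → inS y ≡ false → ev V y (◇ A) ≡ true → V' p y ≡ ev V y (copyBranch p)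
    unifier-seen {p} {y} hy hd =
      trans (eval-unifier p y) (trans (if-cong hy) (trans (eval-belowBranch p y) (if-cong hd)))

    agrees-on-S : ∀ χ {z} → inS z ≡ true → ev V' z χ ≡ ev V z χ
    agrees-on-S χ hz = eval-local χ λ p zy → unifier-on-S (S-upward hz zy)

    projective : ∀ p x → ev V x (□ φ ⇒ (var p ⇔ unifier φ c p)) ≡ true
    projective p x = ⇒-intro V x A (var p ⇔ unifier φ c p) λ hx →
                     ⇔-intro V x (var p) (unifier φ c p) (sym (unifier-on-S hx))

    □onS-intro : ∀ {w} ψ → (∀ {y} → inS y ≡ true → ev V y ψ ≡ true) → ev V w (□ (A ⇒ ψ)) ≡ true
    □onS-intro {w} ψ h = □-intro V w (A ⇒ ψ) λ y _ → ⇒-intro V y A ψ h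

    □onS-elim : ∀ {w y} ψ → inS w ≡ false → ev V w (□ (A ⇒ ψ)) ≡ true →
                inS y ≡ true → ev V y ψ ≡ true
    □onS-elim {w} {y} ψ hw h hy = ⇒-elim V y A ψ (□-elim V w (A ⇒ ψ) h y (sees-S hw hy)) hy

    □onS-uniform : ∀ {w w'} ψ → inS w ≡ false → inS w' ≡ false →
                   ev V w (□ (A ⇒ ψ)) ≡ ev V w' (□ (A ⇒ ψ))
    □onS-uniform ψ hw hw' = ≡-by-iff (λ h → □onS-intro ψ (□onS-elim ψ hw h))
                                     (λ h → □onS-intro ψ (□onS-elim ψ hw' h))

    module Unseen {x : Point} (x⊭◇S : ev V x (◇ A) ≡ false) where

      unseen-S : ∀ {y} → x ⇝ y ≡ true → inS y ≡ false
      unseen-S {y} xy with inS y in y∈S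
      ... | true  = absurdᵇ (◇-intro V x A y xy y∈S) x⊭◇S
      ... | false = refl

      unseen-◇S : ∀ {y} → x ⇝ y ≡ true → ev V y (◇ A) ≡ false
      unseen-◇S {y} xy with ev V y (◇ A) in y⊨◇S
      ... | false = refl
      ... | true with ◇-elim V y A y⊨◇S
      ...   | z , yz , z∈S = absurdᵇ (◇-intro V x A z (transitive xy yz) z∈S) x⊭◇S

      φ-holds : ev V' x φ ≡ true
      φ-holds = begin
        ev V' x φ              ≡⟨ eval-local φ (λ p xy → unifier-unseen (unseen-S xy) (unseen-◇S xy)) ⟩
        ev (λ p _ → c p) x φ   ≡⟨ eval-constant c φ x ⟩
        bval c φ               ≡⟨ c-sat ⟩
        true                   ∎

    module Seen {w₀ : Point} (w₀∉S : inS w₀ ≡ false) (w₀⊨◇S : ev V w₀ (◇ A) ≡ true) where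

      S-valid : Fm → Bool
      S-valid ψ = ev V w₀ (□ (A ⇒ ψ))

      -- the points of S verifying □ψ, for ψ boxed in φ, only if ψ holds throughout S
      Typical : Fm
      Typical = refine S-valid boxedφ A

      typical : Point → Bool
      typical y = ev V y Typical

      first-typical : Σ Point λ s₀ → typical s₀ ≡ true
      first-typical with ◇-elim V w₀ A w₀⊨◇S
      ... | s , _ , s∈S with least-point inS s∈S
      ...   | s₀ , s₀∈S , s₀-least =
        s₀ , refine-complete V s₀ S-valid boxedφ A s₀∈S
               λ {ψ} _ □ψ → □onS-intro ψ λ {y} y∈S → □-elim V s₀ ψ □ψ y (s₀-least y∈S)

      last-typical : Σ Point λ e → typical e ≡ true × (∀ {y} → typical y ≡ true → y ⇝ e ≡ true)
      last-typical = greatest-point typical (proj₂ first-typical)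

      e : Point
      e = proj₁ last-typical

      e-typical : typical e ≡ true
      e-typical = proj₁ (proj₂ last-typical)

      e-greatest : ∀ {y} → typical y ≡ true → y ⇝ e ≡ true
      e-greatest = proj₂ (proj₂ last-typical)

      e∈S : inS e ≡ true
      e∈S = proj₁ (refine-sound V e S-valid boxedφ A e-typical)

      e-last : ∀ {z} → typical z ≡ true → e ⇝ z ≡ true → z ≡ e
      e-last {z} tz ez with z ≟ e
      ... | yes z≡e = z≡e
      ... | no  z≢e = absurdᵇ (S-upward z∈S (cluster-root (e-greatest tz) ez z≢e w₀)) w₀∉S
        where
        z∈S : inS z ≡ true
        z∈S = proj₁ (refine-sound V z S-valid boxedφ A tz)

      atLast-e : ∀ {w p} → inS w ≡ false → ev V w (atLast Typical p) ≡ V p e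
      atLast-e {w} {p} hw = ≡-by-iff to from
        where
        to : ev V w (atLast Typical p) ≡ true → V p e ≡ true
        to h with ◇-elim V w (Typical ∧ᶠ □ (Typical ⇒ var p)) h
        ... | y , _ , hy =
          ⇒-elim V e Typical (var p)
            (□-elim V y (Typical ⇒ var p) (∧-conicalʳ _ _ hy) e (e-greatest (∧-conicalˡ _ _ hy)))
            e-typical
        from : V p e ≡ true → ev V w (atLast Typical p) ≡ true
        from hp = ◇-intro V w (Typical ∧ᶠ □ (Typical ⇒ var p)) e (sees-S hw e∈S)
          (cong₂ _∧_ e-typical (□-intro V e (Typical ⇒ var p) λ z ez →
            ⇒-intro V z Typical (var p) λ tz → subst (λ u → V p u ≡ true) (sym (e-last tz ez)) hp))

      copies-e : ∀ {p w} → inS w ≡ false → V' p w ≡ V p e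
      copies-e {p} {w} hw = begin
        V' p w
          ≡⟨ unifier-seen hw (◇-intro V w A e (sees-S hw e∈S) e∈S) ⟩
        ev V w (copyBranch p)
          ≡⟨ eval-atLastRefined V w A boxedφ A p ⟩
        ev V w (atLast (refine (λ ψ → ev V w (□ (A ⇒ ψ))) boxedφ A) p)
          ≡⟨ cong (λ D → ev V w (atLast D p)) (refine-cong boxedφ A λ ψ → □onS-uniform ψ hw w₀∉S) ⟩
        ev V w (atLast Typical p)
          ≡⟨ atLast-e hw ⟩
        V p e ∎

      transfer : ∀ χ → boxedSubformulas χ ⊆ boxedφ → ∀ {w} → inS w ≡ false → ev V' w χ ≡ ev V e χ
      transfer (var p)  sub hw = copies-e hw
      transfer ⊥ᶠ       sub hw = refl
      transfer (a ⇒ b)  sub hw = cong₂ (λ u v → not u ∨ v) (transfer a (sub ∘ xs⊆xs++ys _ _) hw)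
                                                           (transfer b (sub ∘ xs⊆ys++xs _ _) hw)
      transfer (a ∧ᶠ b) sub hw = cong₂ _∧_ (transfer a (sub ∘ xs⊆xs++ys _ _) hw)
                                           (transfer b (sub ∘ xs⊆ys++xs _ _) hw)
      transfer (a ∨ᶠ b) sub hw = cong₂ _∨_ (transfer a (sub ∘ xs⊆xs++ys _ _) hw)
                                           (transfer b (sub ∘ xs⊆ys++xs _ _) hw)
      transfer (□ χ) sub {w} hw = ≡-by-iff to from
        where
        to : ev V' w (□ χ) ≡ true → ev V e (□ χ) ≡ true
        to h = □-intro V e χ at
          where
          at : ∀ z → e ⇝ z ≡ true → ev V z χ ≡ true
          at z ez = trans (sym (agrees-on-S χ z∈S)) (□-elim V' w χ h z (sees-S hw z∈S))
            where
            z∈S : inS z ≡ true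
            z∈S = S-upward e∈S ez
        from : ev V e (□ χ) ≡ true → ev V' w (□ χ) ≡ true
        from h = □-intro V' w χ at
          where
          χ-on-S : S-valid χ ≡ true
          χ-on-S = proj₂ (refine-sound V e S-valid boxedφ A e-typical) (sub (here refl)) h
          at : ∀ y → w ⇝ y ≡ true → ev V' y χ ≡ true
          at y _ with inS y in y∈S
          ... | true  = trans (agrees-on-S χ y∈S) (□onS-elim χ w₀∉S χ-on-S y∈S)
          ... | false = trans (transfer χ (sub ∘ there) y∈S) (□-elim V e χ h e (reflexive e))

      φ-holds : ev V' w₀ φ ≡ true
      φ-holds = trans (transfer φ id w₀∉S) (□-elim V e φ e∈S e (reflexive e))

    φ-holds : ∀ x → ev V' x φ ≡ true
    φ-holds x with inS x in x∈S | ev V x (◇ A) in x⊨◇S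
    ... | true  | _     = trans (agrees-on-S φ x∈S) (□-elim V x φ x∈S x (reflexive x))
    ... | false | false = Unseen.φ-holds x⊨◇S
    ... | false | true  = Seen.φ-holds x∈S x⊨◇S

    unifies : ∀ x → ev V x (φ [ unifier φ c ]) ≡ true
    unifies x = trans (eval-subst V x φ (unifier φ c)) (φ-holds x)

ValidInAll : (ℕ → FinFrame) → Logic
ValidInAll Fk φ = ∀ k → ValidIn (Fk k) φ

projective⇒unitary : ∀ Fk → ProjectiveUnification (ValidInAll Fk) →
                     UnitaryType (ValidInAll Fk)
projective⇒unitary Fk projective φ unifiable with projective φ unifiable
... | τ , τ-unifies , τ-projective = τ , τ-unifies , λ σ σ-unifies → σ , λ p p∈φ k →
  valid-□-mp (Fk k) (φ [ σ ]) (σ p ⇔ (τ p [ σ ]))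
    (valid-subst (Fk k) (□ φ ⇒ (var p ⇔ τ p)) σ (τ-projective p p∈φ k)) (σ-unifies k)
  where open Semantics using (valid-□-mp; valid-subst)

projectiveUnification : ∀ Fk → (∀ k → IsRootClusterChain (Fk k)) → Fin (size (Fk 0)) →
                        ProjectiveUnification (ValidInAll Fk)
projectiveUnification Fk isF x₀ φ (σ , σ-unifies) =
  unifier φ c , (λ k → UnifierModel.unifies (isF k) φ c c-sat) ,
  λ p _ k V → UnifierModel.projective (isF k) φ c c-sat V p
  where
  open RootClusterChain using (module UnifierModel; eval-constant)
  c : ℕ → Bool
  c p = bval (λ _ → true) (σ p)
  -- σ followed by the all-true valuation is a ground unifier
  c-sat : bval c φ ≡ true
  c-sat = begin
    bval c φ                                ≡⟨ bval-subst (λ _ → true) φ σ ⟨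
    bval (λ _ → true) (φ [ σ ])             ≡⟨ eval-constant (isF 0) (λ _ → true) (φ [ σ ]) x₀ ⟨
    eval (Fk 0) (λ _ _ → true) x₀ (φ [ σ ]) ≡⟨ σ-unifies 0 (λ _ _ → true) x₀ ⟩
    true                                    ∎

≤ᵇ-true⇒≤ : ∀ m n → (m ≤ᵇ n) ≡ true → m ≤ n
≤ᵇ-true⇒≤ m n h = ≤ᵇ⇒≤ m n (Equivalence.from T-≡ h)

≤⇒≤ᵇ-true : ∀ {m n} → m ≤ n → (m ≤ᵇ n) ≡ true
≤⇒≤ᵇ-true m≤n = Equivalence.to T-≡ (≤⇒≤ᵇ m≤n)

chain-isRootClusterChain : ∀ k → IsRootClusterChain (chain k)
chain-isRootClusterChain k = record
  { reflexive    = λ x → ≤⇒≤ᵇ-true (≤-refl {toℕ x})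
  ; transitive   = λ {x} {y} {z} xy yz → ≤⇒≤ᵇ-true (≤-trans (R⇒≤ x y xy) (R⇒≤ y z yz))
  ; connected    = connected
  ; cluster-root = λ {x} {y} xy yx x≢y _ →
                     ⊥-elim (x≢y (toℕ-injective (≤-antisym (R⇒≤ x y xy) (R⇒≤ y x yx))))
  }
  where
  R⇒≤ : ∀ x y → R (chain k) x y ≡ true → toℕ x ≤ toℕ y
  R⇒≤ x y = ≤ᵇ-true⇒≤ (toℕ x) (toℕ y)

  connected : ∀ x y → R (chain k) x y ≡ true ⊎ R (chain k) y x ≡ true
  connected x y with ≤-total (toℕ x) (toℕ y)
  ... | inj₁ x≤y = inj₁ (≤⇒≤ᵇ-true x≤y)
  ... | inj₂ y≤x = inj₂ (≤⇒≤ᵇ-true y≤x)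

module PM4Frame (k : ℕ) where

  low top : Fin (suc (suc k)) → Bool
  low x = toℕ x ≤ᵇ k
  top x = toℕ x ≡ᵇ suc k

  top⇒toℕ : ∀ x → top x ≡ true → toℕ x ≡ suc k
  top⇒toℕ x h = ≡ᵇ⇒≡ (toℕ x) (suc k) (Equivalence.from T-≡ h)

  top-if-not-low : ∀ x → low x ≡ false → top x ≡ true
  top-if-not-low x h = Equivalence.to T-≡ (≡⇒≡ᵇ (toℕ x) (suc k) (≤-antisym (s≤s⁻¹ (toℕ<n x)) k<x))
    where
    k<x : suc k ≤ toℕ x
    k<x = ≰⇒> λ x≤k → absurdᵇ (≤⇒≤ᵇ-true x≤k) h

  not-low-if-top : ∀ x → top x ≡ true → low x ≡ false
  not-low-if-top x h with low x in lx
  ... | false = refl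
  ... | true  = ⊥-elim (1+n≰n (subst (_≤ k) (top⇒toℕ x h) (≤ᵇ-true⇒≤ (toℕ x) k lx)))

  isRootClusterChain : IsRootClusterChain (pm4Frame k)
  isRootClusterChain = record
    { reflexive    = reflexive
    ; transitive   = λ {x} {y} {z} → transitive x y z
    ; connected    = connected
    ; cluster-root = λ {x} {y} → cluster-root x y
    }
    where
    reflexive : ∀ x → low x ∨ top x ≡ true
    reflexive x with low x in lx
    ... | true  = refl
    ... | false = top-if-not-low x lx

    transitive : ∀ x y z → low x ∨ top y ≡ true → low y ∨ top z ≡ true → low x ∨ top z ≡ true
    transitive x y z xy yz with low x in lx | top z in tz
    ... | true  | _     = refl
    ... | false | true  = refl
    ... | false | false = absurdᵇ (trans (sym (∨-identityʳ (low y))) yz) (not-low-if-top y xy)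

    connected : ∀ x y → low x ∨ top y ≡ true ⊎ low y ∨ top x ≡ true
    connected x y with low x in lx
    ... | true  = inj₁ refl
    ... | false = inj₂ (trans (cong (low y ∨_) (top-if-not-low x lx)) (∨-zeroʳ (low y)))

    cluster-root : ∀ x y → low x ∨ top y ≡ true → low y ∨ top x ≡ true → x ≢ y →
                   ∀ z → low x ∨ top z ≡ true
    cluster-root x y xy _ x≢y z with low x in lx
    ... | true  = refl
    ... | false = ⊥-elim (x≢y (toℕ-injective (trans (top⇒toℕ x (top-if-not-low x lx))
                                                     (sym (top⇒toℕ y xy)))))

corollary3 : (ProjectiveUnification PM1 × UnitaryType PM1) × (ProjectiveUnification PM4 × UnitaryType PM4)
corollary3 = (pm1-projective , projective⇒unitary chain pm1-projective)
           , (pm4-projective , projective⇒unitary pm4Frame pm4-projective)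
  where
  pm1-projective : ProjectiveUnification PM1
  pm1-projective = projectiveUnification chain chain-isRootClusterChain Fin.zero
  pm4-projective : ProjectiveUnification PM4
  pm4-projective = projectiveUnification pm4Frame PM4Frame.isRootClusterChain Fin.zero
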